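{- Let $Q$ be a positive integer. If there exists a positive integer $n$ with $S_{Qn}(Qn)\equiv n\pmod{Qn}$, then $Q$ is a weak primary pseudoperfect number, i.e. $\sum_{p\mid Q}\frac{Q}{p}+1\equiv 0\pmod{Q}$, where the sum is over primes $p$ dividing $Q$.
   Context: For positive integers $m,k$, $S_m(k):=1^m+2^m+\cdots+k^m$. -}

module Defs where

open import Data.Nat using (ℕ; zero; suc; _+_; _*_; _^_)
open import Data.Nat.Divisibility using (_∣_; _∣?_; quotient)
open import Data.Nat.Primality using (Prime; prime?)
open import Relation.Nullary using (yes; no)
open import Relation.Nullary.Decidable using (_×-dec_)
open import Data.Product using (_,_)
open import Data.Integer using (ℤ; +_; _-_)
open import Data.Integer.Divisibility as ℤDiv using ()

S : ℕ → ℕ → ℕ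
S m zero    = 0
S m (suc k) = S m k + suc k ^ m

primeCoSumUpTo : ℕ → ℕ → ℕ
primeCoSumUpTo Q zero    = 0
primeCoSumUpTo Q (suc b) with prime? (suc b) ×-dec (suc b ∣? Q)
... | yes (_ , d) = primeCoSumUpTo Q b + quotient d
... | no  _       = primeCoSumUpTo Q b

-- Σ_{p ∣ Q, p prime} Q / p  (all prime divisors of Q > 0 are ≤ Q)
primeCoSum : ℕ → ℕ
primeCoSum Q = primeCoSumUpTo Q Q

_≡_[mod_] : ℕ → ℕ → ℕ → Set
a ≡ b [mod m ] = (+ m) ℤDiv.∣ (+ a - + b)

{-# OPTIONS --safe #-}
-- Fix a prime p ∣ Q and write Q = q p, n = pᵉ m with p ∤ m, N = Q n. Since pᵉ ∣ N, lifting the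
-- exponent (a ≡ b mod p ⇒ a^(pᵉ) ≡ b^(pᵉ) mod pᵉ⁺¹) makes j ↦ j^N periodic modulo pᵉ⁺¹ with period p,
-- so S_N(N) ≡ (N/p) S_N(p) = q n S_N(p). Against the hypothesis S_N(N) ≡ n mod pᵉ⁺¹, cancelling pᵉ m
-- leaves q S_N(p) ≡ 1 (mod p). By Fermat and the vanishing of Σ_{r<p} r^k mod p for k < p − 1,
-- S_N(p) ≡ 0 or −1 (mod p); hence S_N(p) ≡ −1 and q ≡ −1 (mod p). So p² ∤ Q, and p divides
-- Q/p + 1 ≡ Σ_{p'∣Q} Q/p' + 1 (mod p); Q being square-free, these local facts give Q ∣ Σ_{p∣Q} Q/p + 1.
module Submission where

open import Defs
open import Data.Product using (∃-syntax; _×_; _,_; proj₁; proj₂)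
open import Data.Sum using (_⊎_; inj₁; inj₂)
open import Function using (_∘_)
open import Relation.Nullary using (¬_; contradiction)
open import Relation.Binary.PropositionalEquality

module FiniteSums where
  open import Data.Nat
  open import Data.Nat.Properties
  open import Data.Nat.Divisibility using (_∣_; ∣m∣n⇒∣m+n; _∣0)
  open import Data.Nat.Tactic.RingSolver using (solve-∀)
  open ≡-Reasoning

  ∑< : ℕ → (ℕ → ℕ) → ℕ
  ∑< zero    f = 0
  ∑< (suc n) f = ∑< n f + f n

  infix 5 ∑<
  syntax ∑< n (λ i → e) = ∑[ i < n ] e

  ∑-cong : ∀ n {f g} → (∀ {i} → i < n → f i ≡ g i) → ∑< n f ≡ ∑< n g
  ∑-cong zero    f≡g = refl
  ∑-cong (suc n) f≡g = cong₂ _+_ (∑-cong n (f≡g ∘ m<n⇒m<1+n)) (f≡g (n<1+n n))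

  ∑-const : ∀ n c → ∑[ i < n ] c ≡ n * c
  ∑-const zero    c = refl
  ∑-const (suc n) c = trans (cong (_+ c) (∑-const n c)) (+-comm (n * c) c)

  ∑-distrib-+ : ∀ n f g → ∑[ i < n ] (f i + g i) ≡ ∑< n f + ∑< n g
  ∑-distrib-+ zero    f g = refl
  ∑-distrib-+ (suc n) f g = begin
    (∑[ i < n ] (f i + g i)) + (f n + g n) ≡⟨ cong (_+ (f n + g n)) (∑-distrib-+ n f g) ⟩
    ∑< n f + ∑< n g + (f n + g n)        ≡⟨ +-interchange (∑< n f) _ _ _ ⟩
    ∑< n f + f n + (∑< n g + g n)        ∎
    where
    +-interchange : ∀ a b c d → a + b + (c + d) ≡ a + c + (b + d)
    +-interchange = solve-∀

  *-distribˡ-∑ : ∀ n c f → c * ∑< n f ≡ ∑[ i < n ] (c * f i)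
  *-distribˡ-∑ zero    c f = *-zeroʳ c
  *-distribˡ-∑ (suc n) c f =
    trans (*-distribˡ-+ c (∑< n f) (f n)) (cong (_+ c * f n) (*-distribˡ-∑ n c f))

  ∑-comm : ∀ m n (h : ℕ → ℕ → ℕ) → ∑[ i < m ] ∑[ j < n ] h i j ≡ ∑[ j < n ] ∑[ i < m ] h i j
  ∑-comm zero    n h = sym (trans (∑-const n 0) (*-zeroʳ n))
  ∑-comm (suc m) n h = trans (cong (_+ ∑< n (h m)) (∑-comm m n h))
                             (sym (∑-distrib-+ n (λ j → ∑[ i < m ] h i j) (h m)))

  ∑-unconsˡ : ∀ n f → ∑< (suc n) f ≡ f 0 + (∑[ i < n ] f (suc i))
  ∑-unconsˡ zero    f = +-comm 0 (f 0)
  ∑-unconsˡ (suc n) f = trans (cong (_+ f (suc n)) (∑-unconsˡ n f)) (+-assoc (f 0) _ _)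

  ∑-++ : ∀ m n f → ∑< (m + n) f ≡ ∑< m f + (∑[ i < n ] f (m + i))
  ∑-++ m zero    f = trans (cong (λ k → ∑< k f) (+-identityʳ m)) (sym (+-identityʳ _))
  ∑-++ m (suc n) f = begin
    ∑< (m + suc n) f                                ≡⟨ cong (λ k → ∑< k f) (+-suc m n) ⟩
    ∑< (m + n) f + f (m + n)                        ≡⟨ cong (_+ f (m + n)) (∑-++ m n f) ⟩
    ∑< m f + (∑[ i < n ] f (m + i)) + f (m + n)    ≡⟨ +-assoc (∑< m f) _ _ ⟩
    ∑< m f + (∑[ i < suc n ] f (m + i))             ∎

  ∣-∑ : ∀ {d} n {f} → (∀ {i} → i < n → d ∣ f i) → d ∣ ∑< n f
  ∣-∑ zero    d∣f = _ ∣0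
  ∣-∑ (suc n) d∣f = ∣m∣n⇒∣m+n (∣-∑ n (d∣f ∘ m<n⇒m<1+n)) (d∣f (n<1+n n))

  S≡∑ : ∀ m k → S m k ≡ ∑[ j < k ] suc j ^ m
  S≡∑ m zero    = refl
  S≡∑ m (suc k) = cong (_+ suc k ^ m) (S≡∑ m k)

open FiniteSums

module PrimeDivisors where
  open import Data.Nat using (_*_; _<_; nonTrivial⇒n>1)
  open import Data.Nat.Divisibility using (_∣_)
  open import Data.Nat.Primality using (Prime; euclidsLemma; prime⇒nonTrivial)

  prime⇒1<p : ∀ {p} → Prime p → 1 < p
  prime⇒1<p {p} p-prime = nonTrivial⇒n>1 p {{prime⇒nonTrivial p-prime}}

  ∣m*n∧∤m⇒∣n : ∀ {p m n} → Prime p → p ∣ m * n → ¬ p ∣ m → p ∣ n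
  ∣m*n∧∤m⇒∣n {m = m} {n} p-prime p∣mn p∤m with euclidsLemma m n p-prime p∣mn
  ... | inj₁ p∣m = contradiction p∣m p∤m
  ... | inj₂ p∣n = p∣n

open PrimeDivisors

module BinomialCoefficients where
  open import Data.Nat
  open import Data.Nat.Properties
  open import Data.Nat.Divisibility using (_∣_; divides; >⇒∤)
  open import Data.Nat.Combinatorics
  open import Data.Nat.Primality using (Prime)
  open import Data.Fin using (toℕ)
  open import Data.Nat.Tactic.RingSolver using (solve-∀)
  import Algebra.Properties.Semiring.Binomial as Binomial
  import Algebra.Definitions.RawSemiring as RawSemiring
  open ≡-Reasoning

  private
    module ℕ-Semiring = RawSemiring +-*-rawSemiring

    ×≡* : ∀ m x → m ℕ-Semiring.× x ≡ m * x
    ×≡* zero    x = refl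
    ×≡* (suc m) x = cong (x +_) (×≡* m x)

    ^≡^ : ∀ x n → x ℕ-Semiring.^ n ≡ x ^ n
    ^≡^ x zero    = refl
    ^≡^ x (suc n) = cong (x *_) (^≡^ x n)

    sum≡∑ : ∀ n f → ℕ-Semiring.sum {n} (f ∘ toℕ) ≡ ∑< n f
    sum≡∑ zero    f = refl
    sum≡∑ (suc n) f = trans (cong (f 0 +_) (sum≡∑ n (f ∘ suc))) (sym (∑-unconsˡ n f))

  binomial-theorem : ∀ x n → suc x ^ n ≡ ∑[ k < suc n ] (n C k) * x ^ k
  binomial-theorem x n = begin
    suc x ^ n                      ≡⟨ cong (_^ n) (+-comm 1 x) ⟩
    (x + 1) ^ n                    ≡⟨ ^≡^ (x + 1) n ⟨
    (x + 1) ℕ-Semiring.^ n         ≡⟨ Binomial.theorem +-*-semiring x 1 (*-comm x 1) n ⟩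
    ℕ-Semiring.sum {suc n} (term ∘ toℕ) ≡⟨ sum≡∑ (suc n) term ⟩
    ∑< (suc n) term                ≡⟨ ∑-cong (suc n) (λ {k} _ → term≡ k) ⟩
    ∑[ k < suc n ] (n C k) * x ^ k   ∎
    where
    term : ℕ → ℕ
    term k = (n C k) ℕ-Semiring.× (x ℕ-Semiring.^ k * 1 ℕ-Semiring.^ (n ∸ k))
    term≡ : ∀ k → term k ≡ (n C k) * x ^ k
    term≡ k = begin
      term k                                ≡⟨ ×≡* (n C k) _ ⟩
      (n C k) * (x ℕ-Semiring.^ k * 1 ℕ-Semiring.^ (n ∸ k))
        ≡⟨ cong₂ (λ a b → (n C k) * (a * b)) (^≡^ x k) (trans (^≡^ 1 (n ∸ k)) (^-zeroˡ (n ∸ k))) ⟩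
      (n C k) * (x ^ k * 1)                   ≡⟨ cong ((n C k) *_) (*-identityʳ (x ^ k)) ⟩
      (n C k) * x ^ k                         ∎

  absorption : ∀ n k → suc k * (suc n C suc k) ≡ suc n * (n C k)
  absorption zero    zero    = refl
  absorption zero    (suc k) =
    trans (cong (suc (suc k) *_) (k>n⇒nCk≡0 {1} {suc (suc k)} (s<s z<s))) (*-zeroʳ (suc (suc k)))
  absorption (suc n) zero    = trans (*-identityˡ _) (trans (nC1≡n (suc (suc n))) (sym (*-identityʳ _)))
  absorption (suc n) (suc k) = begin
    suc (suc k) * (suc (suc n) C suc (suc k))  ≡⟨ cong (suc (suc k) *_) (pascal (suc n) (suc k)) ⟨
    suc (suc k) * (A + B)                      ≡⟨ regroupˡ (suc k) A B ⟩
    A + suc k * A + suc (suc k) * B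
      ≡⟨ cong₂ (λ a b → A + a + b) (absorption n k) (absorption n (suc k)) ⟩
    A + suc n * (n C k) + suc n * (n C suc k)  ≡⟨ regroupʳ A (suc n) (n C k) (n C suc k) ⟩
    A + suc n * (n C k + n C suc k)            ≡⟨ cong (λ a → A + suc n * a) (pascal n k) ⟩
    suc (suc n) * A                            ∎
    where
    pascal = nCk+nC[k+1]≡[n+1]C[k+1]
    A = suc n C suc k
    B = suc n C suc (suc k)
    regroupˡ : ∀ k a b → suc k * (a + b) ≡ a + k * a + suc k * b
    regroupˡ = solve-∀
    regroupʳ : ∀ a c x y → a + c * x + c * y ≡ a + c * (x + y)
    regroupʳ = solve-∀

  [1+n]Cn≡1+n : ∀ n → suc n C n ≡ suc n
  [1+n]Cn≡1+n n = trans (nCk≡nC[n∸k] (n≤1+n n)) (trans (cong (suc n C_) (m+n∸n≡m 1 n)) (nC1≡n (suc n)))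

  prime⇒p∣pCk : ∀ {p k} → Prime p → 0 < k → k < p → p ∣ p C k
  prime⇒p∣pCk {suc n} {suc j} p-prime _ k<p =
    ∣m*n∧∤m⇒∣n p-prime (divides (n C j) (trans (absorption n j) (*-comm (suc n) (n C j)))) (>⇒∤ k<p)

open BinomialCoefficients

private module ℤ-Identities where
  open import Data.Integer.Base
  open import Data.Integer.Tactic.RingSolver using (solve-∀)

  a-a≡0*a : ∀ a → a - a ≡ 0ℤ * a
  a-a≡0*a = solve-∀
  b-a≡-[a-b] : ∀ a b → b - a ≡ - (a - b)
  b-a≡-[a-b] = solve-∀
  a-c≡[a-b]+[b-c] : ∀ a b c → a - c ≡ (a - b) + (b - c)
  a-c≡[a-b]+[b-c] = solve-∀
  [a+c]-[b+d] : ∀ a b c d → (a + c) - (b + d) ≡ (a - b) + (c - d)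
  [a+c]-[b+d] = solve-∀
  ac-bd : ∀ a b c d → a * c - b * d ≡ c * (a - b) + b * (c - d)
  ac-bd = solve-∀
  ca-cb : ∀ c a b → c * a - c * b ≡ c * (a - b)
  ca-cb = solve-∀
  a≡a-0 : ∀ a → a ≡ a - 0ℤ
  a≡a-0 = solve-∀
  [a-b]g : ∀ x y a b g → (a - b) * g ≡ (x - y) + ((y + a * g) - (x + b * g))
  [a-b]g = solve-∀
  u+[w-w] : ∀ u w → u + (w - w) ≡ u
  u+[w-w] = solve-∀

module Congruences where
  open import Data.Nat
  open import Data.Nat.Properties using (+-comm; n<1+n; m<n⇒m<1+n)
  open import Data.Nat.Divisibility using (_∣_)
  open import Data.Nat.Primality using (Prime)
  open import Data.Integer.Base as ℤ using (ℤ; +_; 0ℤ)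
  open import Data.Integer.Properties as ℤ using (pos-+; pos-*)
  open import Data.Integer.Divisibility.Signed as ℤ using (∣ᵤ⇒∣; ∣⇒∣ᵤ)
  open import Relation.Binary.Bundles using (Setoid)
  import Relation.Binary.Reasoning.Setoid as SetoidReasoning

  -- Defs' a ≡ b [mod m ] unfolds, so a, b and m cannot be inferred from it; this record is an
  -- injective copy, phrased with signed divisibility for its richer API.
  infix 4 _≡_⟨mod_⟩
  record _≡_⟨mod_⟩ (a b m : ℕ) : Set where
    constructor congruent
    field m∣a-b : + m ℤ.∣ + a ℤ.- + b
  open _≡_⟨mod_⟩

  [mod]⇒⟨mod⟩ : ∀ {m a b} → a ≡ b [mod m ] → a ≡ b ⟨mod m ⟩
  [mod]⇒⟨mod⟩ m∣a-b = congruent (∣ᵤ⇒∣ m∣a-b)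

  mod-reflexive : ∀ {m a b} → a ≡ b → a ≡ b ⟨mod m ⟩
  mod-reflexive {m} {a} refl = congruent (ℤ.divides 0ℤ (ℤ-Identities.a-a≡0*a (+ a)))

  mod-refl : ∀ {m a} → a ≡ a ⟨mod m ⟩
  mod-refl = mod-reflexive refl

  mod-sym : ∀ {m a b} → a ≡ b ⟨mod m ⟩ → b ≡ a ⟨mod m ⟩
  mod-sym {a = a} {b} a≡b =
    congruent (subst (+ _ ℤ.∣_) (sym (ℤ-Identities.b-a≡-[a-b] (+ a) (+ b))) (ℤ.∣m⇒∣-m (m∣a-b a≡b)))

  mod-trans : ∀ {m a b c} → a ≡ b ⟨mod m ⟩ → b ≡ c ⟨mod m ⟩ → a ≡ c ⟨mod m ⟩
  mod-trans {a = a} {b} {c} a≡b b≡c =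
    congruent (subst (+ _ ℤ.∣_) (sym (ℤ-Identities.a-c≡[a-b]+[b-c] (+ a) (+ b) (+ c)))
      (ℤ.∣m∣n⇒∣m+n (m∣a-b a≡b) (m∣a-b b≡c)))

  ≡-mod-setoid : ℕ → Setoid _ _
  ≡-mod-setoid m = record
    { Carrier = ℕ
    ; _≈_ = λ a b → a ≡ b ⟨mod m ⟩
    ; isEquivalence = record { refl = mod-refl ; sym = mod-sym ; trans = mod-trans }
    }

  module ≡-mod-Reasoning (m : ℕ) = SetoidReasoning (≡-mod-setoid m)

  +-cong-mod : ∀ {m a b c d} → a ≡ b ⟨mod m ⟩ → c ≡ d ⟨mod m ⟩ → a + c ≡ b + d ⟨mod m ⟩
  +-cong-mod {a = a} {b} {c} {d} a≡b c≡d =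
    congruent (subst (+ _ ℤ.∣_) eq (ℤ.∣m∣n⇒∣m+n (m∣a-b a≡b) (m∣a-b c≡d)))
    where
    eq : (+ a ℤ.- + b) ℤ.+ (+ c ℤ.- + d) ≡ + (a + c) ℤ.- + (b + d)
    eq = sym (trans (cong₂ ℤ._-_ (pos-+ a c) (pos-+ b d)) (ℤ-Identities.[a+c]-[b+d] (+ a) (+ b) (+ c) (+ d)))

  *-cong-mod : ∀ {m a b c d} → a ≡ b ⟨mod m ⟩ → c ≡ d ⟨mod m ⟩ → a * c ≡ b * d ⟨mod m ⟩
  *-cong-mod {a = a} {b} {c} {d} a≡b c≡d =
    congruent (subst (+ _ ℤ.∣_) eq
      (ℤ.∣m∣n⇒∣m+n (ℤ.∣n⇒∣m*n (+ c) (m∣a-b a≡b)) (ℤ.∣n⇒∣m*n (+ b) (m∣a-b c≡d))))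
    where
    eq : + c ℤ.* (+ a ℤ.- + b) ℤ.+ + b ℤ.* (+ c ℤ.- + d) ≡ + (a * c) ℤ.- + (b * d)
    eq = sym (trans (cong₂ ℤ._-_ (pos-* a c) (pos-* b d)) (ℤ-Identities.ac-bd (+ a) (+ b) (+ c) (+ d)))

  ^-cong-mod : ∀ {m a b} n → a ≡ b ⟨mod m ⟩ → a ^ n ≡ b ^ n ⟨mod m ⟩
  ^-cong-mod zero    a≡b = mod-refl
  ^-cong-mod (suc n) a≡b = *-cong-mod a≡b (^-cong-mod n a≡b)

  ∑-cong-mod : ∀ {m} n {f g} → (∀ {i} → i < n → f i ≡ g i ⟨mod m ⟩) → ∑< n f ≡ ∑< n g ⟨mod m ⟩
  ∑-cong-mod zero    f≡g = mod-refl
  ∑-cong-mod (suc n) f≡g = +-cong-mod (∑-cong-mod n (f≡g ∘ m<n⇒m<1+n)) (f≡g (n<1+n n))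

  ∑-periodic-mod : ∀ {m} p f → (∀ j r → f (j * p + r) ≡ f r ⟨mod m ⟩) →
                   ∀ k → ∑< (k * p) f ≡ k * ∑< p f ⟨mod m ⟩
  ∑-periodic-mod     p f periodic zero    = mod-refl
  ∑-periodic-mod {m} p f periodic (suc k) = begin
    ∑< (suc k * p) f                             ≡⟨ cong (λ n → ∑< n f) (+-comm p (k * p)) ⟩
    ∑< (k * p + p) f                             ≡⟨ ∑-++ (k * p) p f ⟩
    ∑< (k * p) f + (∑[ r < p ] f (k * p + r))
      ≈⟨ +-cong-mod (∑-periodic-mod p f periodic k) (∑-cong-mod p (λ {r} _ → periodic k r)) ⟩
    k * ∑< p f + ∑< p f                          ≡⟨ +-comm (k * ∑< p f) (∑< p f) ⟩
    suc k * ∑< p f                               ∎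
    where open ≡-mod-Reasoning m

  ∣⇒≡0-mod : ∀ {m a} → m ∣ a → a ≡ 0 ⟨mod m ⟩
  ∣⇒≡0-mod {m} {a} m∣a =
    congruent (subst (+ m ℤ.∣_) (ℤ-Identities.a≡a-0 (+ a)) (∣ᵤ⇒∣ {+ m} {+ a} m∣a))

  ≡0-mod⇒∣ : ∀ {m a} → a ≡ 0 ⟨mod m ⟩ → m ∣ a
  ≡0-mod⇒∣ {m} {a} a≡0 = ∣⇒∣ᵤ (subst (+ m ℤ.∣_) (sym (ℤ-Identities.a≡a-0 (+ a))) (m∣a-b a≡0))

  ∣-weaken-mod : ∀ {d m a b} → d ∣ m → a ≡ b ⟨mod m ⟩ → a ≡ b ⟨mod d ⟩
  ∣-weaken-mod d∣m a≡b = congruent (ℤ.∣-trans (∣ᵤ⇒∣ {+ _} {+ _} d∣m) (m∣a-b a≡b))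

  private
    ca-cb≡c[a-b] : ∀ c a b → + (c * a) ℤ.- + (c * b) ≡ + c ℤ.* (+ a ℤ.- + b)
    ca-cb≡c[a-b] c a b = trans (cong₂ ℤ._-_ (pos-* c a) (pos-* c b)) (ℤ-Identities.ca-cb (+ c) (+ a) (+ b))

  *-cancelˡ-mod : ∀ c {m a b} .{{_ : NonZero c}} → c * a ≡ c * b ⟨mod c * m ⟩ → a ≡ b ⟨mod m ⟩
  *-cancelˡ-mod c {m} {a} {b} ca≡cb =
    congruent (ℤ.*-cancelˡ-∣ (+ c) (subst₂ ℤ._∣_ (pos-* c m) (ca-cb≡c[a-b] c a b) (m∣a-b ca≡cb)))

  prime-*-cancelˡ-mod : ∀ {p c a b} → Prime p → ¬ p ∣ c → c * a ≡ c * b ⟨mod p ⟩ → a ≡ b ⟨mod p ⟩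
  prime-*-cancelˡ-mod {p} {c} {a} {b} p-prime p∤c ca≡cb =
    congruent (∣ᵤ⇒∣ (∣m*n∧∤m⇒∣n p-prime (subst (p ∣_) (ℤ.abs-* (+ c) (+ a ℤ.- + b)) p∣c[a-b]) p∤c))
    where
    p∣c[a-b] : p ∣ ℤ.∣ + c ℤ.* (+ a ℤ.- + b) ∣
    p∣c[a-b] = ∣⇒∣ᵤ (subst (+ p ℤ.∣_) (ca-cb≡c[a-b] c a b) (m∣a-b ca≡cb))

  -- x − y = (a − b) g, stated without subtraction.
  factored-difference-mod : ∀ {m d x y a b g} →
                            x + b * g ≡ y + a * g → a ≡ b ⟨mod m ⟩ → d ∣ g → x ≡ y ⟨mod m * d ⟩
  factored-difference-mod {m} {d} {x} {y} {a} {b} {g} x+bg≡y+ag a≡b d∣g =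
    congruent (subst₂ ℤ._∣_ (sym (pos-* m d)) [a-b]g≡x-y
      (ℤ.∣-trans (ℤ.*-monoʳ-∣ (+ m) (∣ᵤ⇒∣ {+ d} {+ g} d∣g)) (ℤ.*-monoˡ-∣ (+ g) (m∣a-b a≡b))))
    where
    open ≡-Reasoning
    X = + x ℤ.+ + b ℤ.* + g
    Y = + y ℤ.+ + a ℤ.* + g
    cast : ∀ u v w → + (u + v * w) ≡ + u ℤ.+ + v ℤ.* + w
    cast u v w = trans (pos-+ u (v * w)) (cong (λ z → + u ℤ.+ z) (pos-* v w))
    X≡Y : X ≡ Y
    X≡Y = trans (sym (cast x b g)) (trans (cong +_ x+bg≡y+ag) (cast y a g))
    [a-b]g≡x-y : (+ a ℤ.- + b) ℤ.* + g ≡ + x ℤ.- + y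
    [a-b]g≡x-y = begin
      (+ a ℤ.- + b) ℤ.* + g          ≡⟨ ℤ-Identities.[a-b]g (+ x) (+ y) (+ a) (+ b) (+ g) ⟩
      (+ x ℤ.- + y) ℤ.+ (Y ℤ.- X)    ≡⟨ cong (λ z → (+ x ℤ.- + y) ℤ.+ (Y ℤ.- z)) X≡Y ⟩
      (+ x ℤ.- + y) ℤ.+ (Y ℤ.- Y)    ≡⟨ ℤ-Identities.u+[w-w] (+ x ℤ.- + y) Y ⟩
      + x ℤ.- + y                    ∎

open Congruences

module Fermat where
  open import Data.Nat
  open import Data.Nat.Properties
  open import Data.Nat.Divisibility using (_∣_; ∣m⇒∣m*n)
  open import Data.Nat.Combinatorics using (_C_; nCn≡1)
  open import Data.Nat.Primality using (Prime)

  freshman's-dream : ∀ {p} → Prime p → ∀ x → suc x ^ p ≡ suc (x ^ p) ⟨mod p ⟩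
  freshman's-dream {suc n} p-prime x = begin
    suc x ^ suc n                                             ≡⟨ binomial-theorem x (suc n) ⟩
    (∑[ k < suc n ] (suc n C k) * x ^ k) + (suc n C suc n) * x ^ suc n
      ≡⟨ cong (_+ (suc n C suc n) * x ^ suc n) (∑-unconsˡ n _) ⟩
    1 + (∑[ k < n ] (suc n C suc k) * x ^ suc k) + (suc n C suc n) * x ^ suc n
      ≈⟨ +-cong-mod (+-cong-mod (mod-refl {a = 1}) (∣⇒≡0-mod middle-terms))
                    (mod-reflexive (cong (_* x ^ suc n) (nCn≡1 (suc n)))) ⟩
    1 + 0 + 1 * x ^ suc n                                     ≡⟨ cong suc (*-identityˡ (x ^ suc n)) ⟩
    suc (x ^ suc n)                                           ∎
    where
    open ≡-mod-Reasoning (suc n)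
    middle-terms : suc n ∣ ∑[ k < n ] (suc n C suc k) * x ^ suc k
    middle-terms = ∣-∑ n (λ {k} k<n → ∣m⇒∣m*n (x ^ suc k) (prime⇒p∣pCk p-prime z<s (s<s k<n)))

  fermat : ∀ {p} → Prime p → ∀ x → x ^ p ≡ x ⟨mod p ⟩
  fermat {suc n} p-prime zero    = mod-refl
  fermat {suc n} p-prime (suc x) =
    mod-trans (freshman's-dream p-prime x) (+-cong-mod (mod-refl {a = 1}) (fermat p-prime x))

  ^[p∸1]≡1-mod : ∀ {p r} → Prime p → ¬ p ∣ r → r ^ (p ∸ 1) ≡ 1 ⟨mod p ⟩
  ^[p∸1]≡1-mod {suc n} {r} p-prime p∤r =
    prime-*-cancelˡ-mod p-prime p∤r (mod-trans (fermat p-prime r) (mod-reflexive (sym (*-identityʳ r))))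

  ^-reduce-mod-prime : ∀ {p r} → Prime p → ¬ p ∣ r →
                       ∀ s t → r ^ (s + t * (p ∸ 1)) ≡ r ^ s ⟨mod p ⟩
  ^-reduce-mod-prime {p} {r} p-prime p∤r s t = begin
    r ^ (s + t * (p ∸ 1))        ≡⟨ ^-distribˡ-+-* r s (t * (p ∸ 1)) ⟩
    r ^ s * r ^ (t * (p ∸ 1))    ≡⟨ cong (λ e → r ^ s * r ^ e) (*-comm t (p ∸ 1)) ⟩
    r ^ s * r ^ ((p ∸ 1) * t)    ≡⟨ cong (r ^ s *_) (^-*-assoc r (p ∸ 1) t) ⟨
    r ^ s * (r ^ (p ∸ 1)) ^ t    ≈⟨ *-cong-mod (mod-refl {a = r ^ s}) (^-cong-mod t (^[p∸1]≡1-mod p-prime p∤r)) ⟩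
    r ^ s * 1 ^ t                ≡⟨ cong (r ^ s *_) (^-zeroˡ t) ⟩
    r ^ s * 1                    ≡⟨ *-identityʳ (r ^ s) ⟩
    r ^ s                        ∎
    where open ≡-mod-Reasoning p

open Fermat

module PowerSums where
  open import Data.Nat
  open import Data.Nat.Properties
  open import Data.Nat.Divisibility using (_∣_; ∣n⇒∣m*n; m∣m*n; ∣m+n∣m⇒∣n; >⇒∤; ∣-refl)
  open import Data.Nat.Combinatorics using (_C_; nCn≡1)
  open import Data.Nat.Primality using (Prime)
  open import Data.Nat.Induction using (<-rec)
  open import Data.Nat.DivMod using (_%_; _/_; m%n<n; m≡m%n+[m/n]*n)

  -- The sum starts at r = 0 and 0 ^ 0 = 1, so powerSum p 0 = p.
  powerSum : ℕ → ℕ → ℕ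
  powerSum p k = ∑[ r < p ] r ^ k

  ∑-binomial-powerSum : ∀ p k → ∑[ j < suc k ] (suc k C j) * powerSum p j ≡ p ^ suc k
  ∑-binomial-powerSum p k = +-cancelˡ-≡ T _ _ (begin
    T + L                                                ≡⟨ +-comm T L ⟩
    L + T                                                ≡⟨ cong (L +_) top-term ⟨
    ∑[ j < suc (suc k) ] (suc k C j) * powerSum p j
      ≡⟨ ∑-cong (suc (suc k)) (λ {j} _ → *-distribˡ-∑ p (suc k C j) (_^ j)) ⟩
    ∑[ j < suc (suc k) ] ∑[ r < p ] (suc k C j) * r ^ j   ≡⟨ ∑-comm (suc (suc k)) p _ ⟩
    ∑[ r < p ] ∑[ j < suc (suc k) ] (suc k C j) * r ^ j   ≡⟨ ∑-cong p (λ {r} _ → binomial-theorem r (suc k)) ⟨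
    ∑[ r < p ] suc r ^ suc k                             ≡⟨ ∑-unconsˡ p (_^ suc k) ⟨
    T + p ^ suc k                                        ∎)
    where
    open ≡-Reasoning
    T = powerSum p (suc k)
    L = ∑[ j < suc k ] (suc k C j) * powerSum p j
    top-term : (suc k C suc k) * T ≡ T
    top-term = trans (cong (_* T) (nCn≡1 (suc k))) (*-identityˡ T)

  p∣powerSum : ∀ {p} → Prime p → ∀ k → suc k < p → p ∣ powerSum p k
  p∣powerSum {p} p-prime = <-rec (λ k → suc k < p → p ∣ powerSum p k) step
    where
    step : ∀ k → (∀ {j} → j < k → suc j < p → p ∣ powerSum p j) → suc k < p → p ∣ powerSum p k
    step k p∣lower-powerSums 1+k<p = ∣m*n∧∤m⇒∣n p-prime p∣[1+k]T (>⇒∤ 1+k<p)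
      where
      lower = ∑[ j < k ] (suc k C j) * powerSum p j
      p∣lower : p ∣ lower
      p∣lower = ∣-∑ k (λ {j} j<k → ∣n⇒∣m*n (suc k C j) (p∣lower-powerSums j<k (<-trans (s<s j<k) 1+k<p)))
      lower+[1+k]T≡p^[1+k] : lower + suc k * powerSum p k ≡ p ^ suc k
      lower+[1+k]T≡p^[1+k] =
        trans (cong (λ c → lower + c * powerSum p k) (sym ([1+n]Cn≡1+n k))) (∑-binomial-powerSum p k)
      p∣[1+k]T : p ∣ suc k * powerSum p k
      p∣[1+k]T = ∣m+n∣m⇒∣n (subst (p ∣_) (sym lower+[1+k]T≡p^[1+k]) (m∣m*n (p ^ k))) p∣lower

  -- With N = s + t (p − 1), s < p − 1, Fermat reduces 1^N, …, (p − 1)^N to exponent s; their sum is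
  -- p − 1 for s = 0 and powerSum p s ≡ 0 otherwise.
  S-mod-prime : ∀ {p N} → Prime p → 0 < N → p ∣ S N p ⊎ p ∣ S N p + 1
  S-mod-prime {suc zero} ()
  S-mod-prime {p@(suc n@(suc _))} {N@(suc N-1)} p-prime _ =
    by-remainder (N % n) (m%n<n N n) (m≡m%n+[m/n]*n N n)
    where
    open ≡-mod-Reasoning p

    reduce-exponent : ∀ s t → N ≡ s + t * n → ∑[ j < n ] suc j ^ N ≡ ∑[ j < n ] suc j ^ s ⟨mod p ⟩
    reduce-exponent s t N≡s+t*n =
      subst (λ e → ∑[ j < n ] suc j ^ e ≡ ∑[ j < n ] suc j ^ s ⟨mod p ⟩) (sym N≡s+t*n)
        (∑-cong-mod n (λ j<n → ^-reduce-mod-prime p-prime (>⇒∤ (s<s j<n)) s t))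

    p^N≡0 : p ^ N ≡ 0 ⟨mod p ⟩
    p^N≡0 = ∣⇒≡0-mod (m∣m*n (p ^ N-1))

    by-remainder : ∀ s → s < n → N ≡ s + N / n * n → p ∣ S N p ⊎ p ∣ S N p + 1
    by-remainder zero _ N≡0+t*n = inj₂ (≡0-mod⇒∣ (begin
      S N p + 1                              ≡⟨ cong (_+ 1) (S≡∑ N p) ⟩
      (∑[ j < n ] suc j ^ N) + p ^ N + 1
        ≈⟨ +-cong-mod (+-cong-mod (reduce-exponent 0 (N / n) N≡0+t*n) p^N≡0) (mod-refl {a = 1}) ⟩
      (∑[ j < n ] 1) + 0 + 1                 ≡⟨ cong (λ x → x + 0 + 1) (trans (∑-const n 1) (*-identityʳ n)) ⟩
      n + 0 + 1                              ≡⟨ trans (cong (_+ 1) (+-identityʳ n)) (+-comm n 1) ⟩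
      p                                      ≈⟨ ∣⇒≡0-mod (∣-refl {p}) ⟩
      0                                      ∎))
    by-remainder (suc s) s<n N≡s+t*n = inj₁ (≡0-mod⇒∣ (begin
      S N p                                  ≡⟨ S≡∑ N p ⟩
      (∑[ j < n ] suc j ^ N) + p ^ N         ≈⟨ +-cong-mod (reduce-exponent (suc s) (N / n) N≡s+t*n) p^N≡0 ⟩
      (∑[ j < n ] suc j ^ suc s) + 0         ≡⟨ +-identityʳ _ ⟩
      ∑[ j < n ] suc j ^ suc s               ≡⟨ ∑-unconsˡ n (_^ suc s) ⟨
      powerSum p (suc s)                     ≈⟨ ∣⇒≡0-mod (p∣powerSum p-prime (suc s) (s<s s<n)) ⟩
      0                                      ∎))

open PowerSums

module LiftingTheExponent where
  open import Data.Nat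
  open import Data.Nat.Properties
  open import Data.Nat.Divisibility using (_∣_; m∣m*n; ∣-reflexive)
  open import Data.Nat.Tactic.RingSolver using (solve-∀)

  geometric : ℕ → ℕ → ℕ → ℕ
  geometric a b zero    = 0
  geometric a b (suc n) = a ^ n + b * geometric a b n

  -- aⁿ − bⁿ = (a − b) · geometric a b n, stated without subtraction.
  ^-difference : ∀ a b n → a ^ n + b * geometric a b n ≡ b ^ n + a * geometric a b n
  ^-difference a b zero    = cong (1 +_) (trans (*-zeroʳ b) (sym (*-zeroʳ a)))
  ^-difference a b (suc n) = begin
    a * a ^ n + b * (a ^ n + b * G)   ≡⟨ cong (λ x → a * a ^ n + b * x) (^-difference a b n) ⟩
    a * a ^ n + b * (b ^ n + a * G)   ≡⟨ regroup a b (a ^ n) (b ^ n) G ⟩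
    b * b ^ n + a * (a ^ n + b * G)   ∎
    where
    open ≡-Reasoning
    G = geometric a b n
    regroup : ∀ a b x y g → a * x + b * (y + a * g) ≡ b * y + a * (x + b * g)
    regroup = solve-∀

  geometric-mod : ∀ {m a b} → a ≡ b ⟨mod m ⟩ →
                  ∀ n → geometric a b (suc n) ≡ suc n * b ^ n ⟨mod m ⟩
  geometric-mod {b = b} a≡b zero    = mod-reflexive (cong (1 +_) (*-zeroʳ b))
  geometric-mod {m} {a} {b} a≡b (suc n) = begin
    a ^ suc n + b * geometric a b (suc n)
      ≈⟨ +-cong-mod (^-cong-mod (suc n) a≡b) (*-cong-mod (mod-refl {a = b}) (geometric-mod a≡b n)) ⟩
    b ^ suc n + b * (suc n * b ^ n)         ≡⟨ regroup b (b ^ n) n ⟩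
    suc (suc n) * b ^ suc n                 ∎
    where
    open ≡-mod-Reasoning m
    regroup : ∀ b x n → b * x + b * (suc n * x) ≡ suc (suc n) * (b * x)
    regroup = solve-∀

  ^-lift-mod : ∀ {p m a b} → p ∣ m → a ≡ b ⟨mod m ⟩ → a ^ p ≡ b ^ p ⟨mod m * p ⟩
  ^-lift-mod {zero}         _   _   = mod-refl
  ^-lift-mod {suc n} {a = a} {b} p∣m a≡b =
    factored-difference-mod (^-difference a b (suc n)) a≡b p∣geometric
    where
    p∣geometric : suc n ∣ geometric a b (suc n)
    p∣geometric =
      ≡0-mod⇒∣ (mod-trans (∣-weaken-mod p∣m (geometric-mod a≡b n)) (∣⇒≡0-mod (m∣m*n (b ^ n))))

  ^-lift-mod-pow : ∀ {p a b} e → a ≡ b ⟨mod p ⟩ → a ^ (p ^ e) ≡ b ^ (p ^ e) ⟨mod p ^ suc e ⟩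
  ^-lift-mod-pow {p} {a} {b} zero a≡b = ∣-weaken-mod (∣-reflexive (*-identityʳ p)) (begin
    a ^ 1    ≡⟨ ^-identityʳ a ⟩
    a        ≈⟨ a≡b ⟩
    b        ≡⟨ ^-identityʳ b ⟨
    b ^ 1    ∎)
    where open ≡-mod-Reasoning p
  ^-lift-mod-pow {p} {a} {b} (suc e) a≡b = ∣-weaken-mod (∣-reflexive (*-comm p (p ^ suc e))) (begin
    a ^ (p * p ^ e)      ≡⟨ cong (a ^_) (*-comm p (p ^ e)) ⟩
    a ^ (p ^ e * p)      ≡⟨ ^-*-assoc a (p ^ e) p ⟨
    (a ^ (p ^ e)) ^ p    ≈⟨ ^-lift-mod {p} (m∣m*n (p ^ e)) (^-lift-mod-pow e a≡b) ⟩
    (b ^ (p ^ e)) ^ p    ≡⟨ ^-*-assoc b (p ^ e) p ⟩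
    b ^ (p ^ e * p)      ≡⟨ cong (b ^_) (*-comm (p ^ e) p) ⟩
    b ^ (p * p ^ e)      ∎)
    where open ≡-mod-Reasoning (p ^ suc e * p)

open LiftingTheExponent

module Valuation where
  open import Data.Nat
  open import Data.Nat.Properties
  open import Data.Nat.Divisibility using (_∣_; _∣?_; divides)
  open import Data.Nat.Induction using (<-rec)
  open import Data.Nat.Tactic.RingSolver using (solve-∀)
  open import Relation.Nullary using (yes; no)

  PowerSplit : ℕ → ℕ → Set
  PowerSplit p n = ∃[ e ] ∃[ m ] n ≡ p ^ e * m × ¬ p ∣ m

  power-split : ∀ {p} → 1 < p → ∀ n → 0 < n → PowerSplit p n
  power-split {p} 1<p = <-rec (λ n → 0 < n → PowerSplit p n) step
    where
    step : ∀ n → (∀ {k} → k < n → 0 < k → PowerSplit p k) → 0 < n → PowerSplit p n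
    step n rec 0<n with p ∣? n
    ... | no p∤n = 0 , n , sym (+-identityʳ n) , p∤n
    ... | yes (divides zero n≡0) = contradiction n≡0 (>⇒≢ 0<n)
    ... | yes (divides k@(suc _) n≡k*p) with rec (subst (k <_) (sym n≡k*p) (m<m*n k p 1<p)) z<s
    ...   | e , m , k≡pᵉm , p∤m =
      suc e , m , trans n≡k*p (trans (cong (_* p) k≡pᵉm) (regroup (p ^ e) m p)) , p∤m
      where
      regroup : ∀ x m p → x * m * p ≡ p * x * m
      regroup = solve-∀

open Valuation

module LocalCondition where
  open import Data.Nat
  open import Data.Nat.Properties
  open import Data.Nat.Divisibility using (_∣_; divides; n∣m*n; ∣1⇒≡1; ∣m⇒∣m*n; ∣n⇒∣m*n; ∣-reflexive)
  open import Data.Nat.Primality using (Prime; prime⇒nonZero; ¬prime[1])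
  open import Data.Nat.Tactic.RingSolver using (solve-∀)

  ∑-power-periodic-mod : ∀ {p} e c k →
    ∑[ j < k * p ] suc j ^ (p ^ e * c) ≡ k * (∑[ j < p ] suc j ^ (p ^ e * c)) ⟨mod p ^ suc e ⟩
  ∑-power-periodic-mod {p} e c = ∑-periodic-mod p (λ j → suc j ^ (p ^ e * c)) periodic
    where
    open ≡-mod-Reasoning (p ^ suc e)
    shift : ∀ j r → suc (j * p + r) ≡ suc r ⟨mod p ⟩
    shift j r = subst (λ x → x ≡ suc r ⟨mod p ⟩) (+-suc (j * p) r)
      (+-cong-mod (∣⇒≡0-mod (n∣m*n j)) (mod-refl {a = suc r}))
    periodic : ∀ j r → suc (j * p + r) ^ (p ^ e * c) ≡ suc r ^ (p ^ e * c) ⟨mod p ^ suc e ⟩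
    periodic j r = begin
      suc (j * p + r) ^ (p ^ e * c)    ≡⟨ ^-*-assoc (suc (j * p + r)) (p ^ e) c ⟨
      (suc (j * p + r) ^ p ^ e) ^ c    ≈⟨ ^-cong-mod c (^-lift-mod-pow e (shift j r)) ⟩
      (suc r ^ p ^ e) ^ c              ≡⟨ ^-*-assoc (suc r) (p ^ e) c ⟩
      suc r ^ (p ^ e * c)              ∎

  ¬1≡0-mod-prime : ∀ {p} → Prime p → ¬ 1 ≡ 0 ⟨mod p ⟩
  ¬1≡0-mod-prime p-prime 1≡0 with ∣1⇒≡1 (≡0-mod⇒∣ 1≡0)
  ... | refl = ¬prime[1] p-prime

  qU≡1⇒p∤q∧p∣q+1 : ∀ {p q U} → Prime p → 1 ≡ q * U ⟨mod p ⟩ → p ∣ U ⊎ p ∣ U + 1 →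
                   ¬ p ∣ q × p ∣ q + 1
  qU≡1⇒p∤q∧p∣q+1 {p} {q} {U} p-prime 1≡qU U≡0∨-1 = p∤q , p∣q+1 U≡0∨-1
    where
    open ≡-mod-Reasoning p
    p∤q : ¬ p ∣ q
    p∤q p∣q = ¬1≡0-mod-prime p-prime (mod-trans 1≡qU (∣⇒≡0-mod (∣m⇒∣m*n U p∣q)))
    p∣q+1 : p ∣ U ⊎ p ∣ U + 1 → p ∣ q + 1
    p∣q+1 (inj₁ p∣U)   =
      contradiction (mod-trans 1≡qU (∣⇒≡0-mod (∣n⇒∣m*n q p∣U))) (¬1≡0-mod-prime p-prime)
    p∣q+1 (inj₂ p∣U+1) = ≡0-mod⇒∣ (begin
      q + 1            ≈⟨ +-cong-mod (mod-refl {a = q}) 1≡qU ⟩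
      q + q * U        ≡⟨ *-suc q U ⟨
      q * suc U        ≡⟨ cong (q *_) (+-comm 1 U) ⟩
      q * (U + 1)      ≈⟨ *-cong-mod (mod-refl {a = q}) (∣⇒≡0-mod p∣U+1) ⟩
      q * 0            ≡⟨ *-zeroʳ q ⟩
      0                ∎)

  q*S≡1-mod : ∀ {Q n p q e m} → Prime p → Q ≡ q * p → n ≡ p ^ e * m → ¬ p ∣ m →
              S (Q * n) (Q * n) ≡ n ⟨mod Q * n ⟩ → 1 ≡ q * S (Q * n) p ⟨mod p ⟩
  q*S≡1-mod {Q} {n} {p} {q} {e} {m} p-prime Q≡qp n≡pᵉm p∤m S≡n =
    prime-*-cancelˡ-mod p-prime p∤m (*-cancelˡ-mod (p ^ e) {{m^n≢0 p e {{prime⇒nonZero p-prime}}}}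
      (∣-weaken-mod (∣-reflexive (*-comm (p ^ e) p)) (begin
        p ^ e * (m * 1)                            ≡⟨ trans (cong (p ^ e *_) (*-identityʳ m)) (sym n≡pᵉm) ⟩
        n                                          ≈⟨ mod-sym (∣-weaken-mod pᵉ⁺¹∣N S≡n) ⟩
        S N N                                      ≡⟨ S≡∑ N N ⟩
        ∑[ j < N ] suc j ^ N                       ≡⟨ cong₂ (λ l x → ∑[ j < l ] suc j ^ x) N≡qn*p N≡pᵉc ⟩
        ∑[ j < q * n * p ] suc j ^ (p ^ e * c)     ≈⟨ ∑-power-periodic-mod e c (q * n) ⟩
        q * n * (∑[ j < p ] suc j ^ (p ^ e * c))   ≡⟨ cong (λ x → q * n * (∑[ j < p ] suc j ^ x)) N≡pᵉc ⟨
        q * n * (∑[ j < p ] suc j ^ N)             ≡⟨ cong (q * n *_) (S≡∑ N p) ⟨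
        q * n * S N p                              ≡⟨ cong (λ x → q * x * S N p) n≡pᵉm ⟩
        q * (p ^ e * m) * S N p                    ≡⟨ regroup (p ^ e) m q (S N p) ⟩
        p ^ e * (m * (q * S N p))                  ∎)))
    where
    open ≡-mod-Reasoning (p ^ suc e)
    N = Q * n
    c = q * p * m
    regroup : ∀ x m q U → q * (x * m) * U ≡ x * (m * (q * U))
    regroup = solve-∀
    regroup₁ : ∀ q p n → q * p * n ≡ q * n * p
    regroup₁ = solve-∀
    regroup₂ : ∀ q p x m → q * p * (x * m) ≡ x * (q * p * m)
    regroup₂ = solve-∀
    regroup₃ : ∀ q p x m → q * p * (x * m) ≡ q * m * (p * x)
    regroup₃ = solve-∀
    N≡qn*p : N ≡ q * n * p
    N≡qn*p = trans (cong (_* n) Q≡qp) (regroup₁ q p n)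
    N≡pᵉc : N ≡ p ^ e * c
    N≡pᵉc = trans (cong₂ _*_ Q≡qp n≡pᵉm) (regroup₂ q p (p ^ e) m)
    pᵉ⁺¹∣N : p ^ suc e ∣ N
    pᵉ⁺¹∣N = divides (q * m) (trans (cong₂ _*_ Q≡qp n≡pᵉm) (regroup₃ q p (p ^ e) m))

  local-condition : ∀ {Q n p q} → 0 < Q → 0 < n → Prime p → Q ≡ q * p →
                    S (Q * n) (Q * n) ≡ n ⟨mod Q * n ⟩ → ¬ p ∣ q × p ∣ q + 1
  local-condition {Q} {n} {p} {q} 0<Q 0<n p-prime Q≡qp S≡n
    with power-split (prime⇒1<p p-prime) n 0<n
  ... | e , m , n≡pᵉm , p∤m = qU≡1⇒p∤q∧p∣q+1 p-prime
    (q*S≡1-mod {q = q} {e} p-prime Q≡qp n≡pᵉm p∤m S≡n) (S-mod-prime p-prime (0<m*n 0<Q 0<n))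
    where
    0<m*n : ∀ {m n} → 0 < m → 0 < n → 0 < m * n
    0<m*n {suc m} {suc n} _ _ = z<s

open LocalCondition

module SquareFreeness where
  open import Data.Nat
  open import Data.Nat.Properties using (*-comm)
  open import Data.Nat.Divisibility using (_∣_; divides; 1∣_; m∣m*n; ∣n⇒∣m*n; *-monoʳ-∣; *-monoˡ-∣)
  open import Data.Nat.Primality using (Prime)
  open import Data.Nat.Primality.Factorisation using (factorise; PrimeFactorisation)
  open import Data.Nat.ListAction using (product)
  open import Data.List using ([]; _∷_)
  open import Data.List.Relation.Unary.All using (All; []; _∷_)

  SquareFree : ℕ → Set
  SquareFree n = ∀ {p} → Prime p → ¬ p * p ∣ n

  product-∣ : ∀ {ps X} → All Prime ps → SquareFree (product ps) →
              (∀ {p} → Prime p → p ∣ product ps → p ∣ X) → product ps ∣ X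
  product-∣ {X = X} []                  _  _   = 1∣ X
  product-∣ {p ∷ ps} {X} (p-prime ∷ primes) sf p∣X = p*R∣X R∣X
    where
    R = product ps
    R∣X : R ∣ X
    R∣X = product-∣ primes (λ pr d → sf pr (∣n⇒∣m*n p d)) (λ pr d → p∣X pr (∣n⇒∣m*n p d))
    p∤R : ¬ p ∣ R
    p∤R p∣R = sf p-prime (*-monoʳ-∣ p p∣R)
    p*R∣X : R ∣ X → p * R ∣ X
    p*R∣X (divides t X≡tR) = subst (p * R ∣_) (sym X≡tR) (*-monoˡ-∣ R p∣t)
      where
      p∣t : p ∣ t
      p∣t = ∣m*n∧∤m⇒∣n p-prime (subst (p ∣_) (trans X≡tR (*-comm t R)) (p∣X p-prime (m∣m*n R))) p∤R

  squareFree-∣ : ∀ {Q X} .{{_ : NonZero Q}} → SquareFree Q →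
                 (∀ {p} → Prime p → p ∣ Q → p ∣ X) → Q ∣ X
  squareFree-∣ {Q} {X} sf p∣X = subst (_∣ X) (sym Q≡∏)
    (product-∣ primes (subst SquareFree Q≡∏ sf) (λ pr p∣∏ → p∣X pr (subst (_ ∣_) (sym Q≡∏) p∣∏)))
    where
    f = factorise Q
    open PrimeFactorisation f using () renaming (isFactorisation to Q≡∏; factorsPrime to primes)

open SquareFreeness

module PrimeCoSums where
  open import Data.Nat
  open import Data.Nat.Properties
  open import Data.Nat.Divisibility using (_∣_; _∣?_; divides; quotient; _∣0; ∣m∣n⇒∣m+n; ∣⇒≤)
  open import Data.Nat.Primality using (Prime; prime?; prime⇒irreducible; prime⇒nonZero)
  open import Relation.Nullary using (yes; no)
  open import Relation.Nullary.Decidable using (_×-dec_)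
  open import Data.Nat.Tactic.RingSolver using (solve-∀)

  module _ {Q p q} (p-prime : Prime p) (Q≡qp : Q ≡ q * p) (p∣q+1 : p ∣ q + 1) where

    private
      instance _ = prime⇒nonZero p-prime

      p∣Q : p ∣ Q
      p∣Q = divides q Q≡qp

      +-swapʳ : ∀ a b c → a + b + c ≡ a + c + b
      +-swapʳ = solve-∀

      p∣cofactor : ∀ {d} → Prime d → (d∣Q : d ∣ Q) → d ≢ p → p ∣ quotient d∣Q
      p∣cofactor {d} d-prime (divides k Q≡kd) d≢p =
        ∣m*n∧∤m⇒∣n p-prime (subst (p ∣_) (trans Q≡kd (*-comm k d)) p∣Q) p∤d
        where
        p∤d : ¬ p ∣ d
        p∤d p∣d with prime⇒irreducible d-prime p∣d
        ... | inj₁ p≡1 = contradiction p≡1 (>⇒≢ (prime⇒1<p p-prime))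
        ... | inj₂ p≡d = d≢p (sym p≡d)

      own-cofactor : ∀ {d} → d ≡ p → (d∣Q : d ∣ Q) → quotient d∣Q ≡ q
      own-cofactor refl (divides k Q≡kp) = *-cancelʳ-≡ k q p (trans (sym Q≡kp) Q≡qp)

      below : ∀ b → b < p → p ∣ primeCoSumUpTo Q b
      below zero    _   = p ∣0
      below (suc b) b<p with prime? (suc b) ×-dec (suc b ∣? Q)
      ... | yes (d-prime , d∣Q) =
        ∣m∣n⇒∣m+n (below b (<-trans (n<1+n b) b<p)) (p∣cofactor d-prime d∣Q (<⇒≢ b<p))
      ... | no  _               = below b (<-trans (n<1+n b) b<p)

      from : ∀ b → p ≤ b → p ∣ primeCoSumUpTo Q b + 1
      from zero    p≤0   = contradiction (≤-trans p≤0 z≤n) (<⇒≱ (prime⇒1<p p-prime))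
      from (suc b) p≤1+b with m≤n⇒m<n∨m≡n p≤1+b | prime? (suc b) ×-dec (suc b ∣? Q)
      ... | inj₁ p<1+b | yes (d-prime , d∣Q) =
        subst (p ∣_) (+-swapʳ (primeCoSumUpTo Q b) 1 (quotient d∣Q))
          (∣m∣n⇒∣m+n (from b (s≤s⁻¹ p<1+b)) (p∣cofactor d-prime d∣Q (>⇒≢ p<1+b)))
      ... | inj₁ p<1+b | no  _               = from b (s≤s⁻¹ p<1+b)
      ... | inj₂ p≡1+b | yes (_ , d∣Q)       =
        subst (p ∣_) (trans (cong (λ c → primeCoSumUpTo Q b + (c + 1)) (sym (own-cofactor (sym p≡1+b) d∣Q)))
                            (sym (+-assoc (primeCoSumUpTo Q b) (quotient d∣Q) 1)))
          (∣m∣n⇒∣m+n (below b (subst (b <_) (sym p≡1+b) (n<1+n b))) p∣q+1)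
      ... | inj₂ p≡1+b | no  ¬p-prime∧p∣Q    =
        contradiction (subst Prime p≡1+b p-prime , subst (_∣ Q) p≡1+b p∣Q) ¬p-prime∧p∣Q

    p∣primeCoSum+1 : .{{_ : NonZero Q}} → p ∣ primeCoSum Q + 1
    p∣primeCoSum+1 = from Q (∣⇒≤ p∣Q)

open PrimeCoSums

open import Data.Nat using (ℕ; _+_; _*_; _<_; >-nonZero)
open import Data.Nat.Properties using (*-assoc)
open import Data.Nat.Divisibility using (_∣_; divides)
open import Data.Nat.Primality using (Prime)

corollary1 : (Q : ℕ) → 0 < Q → (∃[ n ] (0 < n × S (Q * n) (Q * n) ≡ n [mod Q * n ])) → Q ∣ primeCoSum Q + 1
corollary1 Q 0<Q (n , 0<n , S≡n) = squareFree-∣ squareFree p∣Q⇒p∣primeCoSum+1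
  where
  instance _ = >-nonZero 0<Q

  local : ∀ {p q} → Prime p → Q ≡ q * p → ¬ p ∣ q × p ∣ q + 1
  local p-prime Q≡qp = local-condition 0<Q 0<n p-prime Q≡qp ([mod]⇒⟨mod⟩ S≡n)

  squareFree : SquareFree Q
  squareFree {p} p-prime (divides r Q≡r[pp]) =
    proj₁ (local p-prime (trans Q≡r[pp] (sym (*-assoc r p p)))) (divides r refl)

  p∣Q⇒p∣primeCoSum+1 : ∀ {p} → Prime p → p ∣ Q → p ∣ primeCoSum Q + 1
  p∣Q⇒p∣primeCoSum+1 p-prime (divides q Q≡qp) =
    p∣primeCoSum+1 {q = q} p-prime Q≡qp (proj₂ (local {q = q} p-prime Q≡qp))
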